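{- Let $D$ be a positive square-free integer, $K=\mathbb{Q}(\sqrt{D})$, and $t$ a unit of the ring of integers $\mathcal{O}_K$. Let $p$ be an odd prime that splits in $K$ as $p\mathcal{O}_K=\mathfrak{p}\bar{\mathfrak{p}}$. Then \[ t^{p-1}\equiv 1\pmod{\mathfrak{p}^2}\iff t^{p-1}\equiv 1\pmod{\bar{\mathfrak{p}}^2}\iff t^{p-1}\equiv 1\pmod{p^2\mathcal{O}_K}. \] -}

module Defs where

open import Data.Nat as ℕ using (ℕ; zero; suc; _%_)
open import Data.Nat.Divisibility using (_∣_)
open import Data.Integer as ℤ using (ℤ; +_; _+_; _*_; -_; _-_)
open import Data.Product using (Σ; ∃; _×_; _,_)
open import Data.Sum using (_⊎_)
open import Data.List using (List; []; _∷_)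
open import Data.Empty using (⊥)
open import Relation.Nullary using (¬_)
open import Relation.Binary.PropositionalEquality using (_≡_)

SquareFree : ℕ → Set
SquareFree D = ∀ (n : ℕ) → n ℕ.* n ∣ D → n ≡ 1

-- Elements of O_K = ℤ[ω] for K = ℚ(√D), written a + b ω, where
--   ω = (1 + √D)/2 if D ≡ 1 (mod 4), and ω = √D otherwise.
-- Then ω² = e ω + f with (e , f) = (1 , (D-1)/4) resp. (0 , D).
record OK : Set where
  constructor _+_ω
  field
    re : ℤ
    im : ℤ
open OK public

eω : ℕ → ℤ
eω D with D % 4
... | 1 = + 1
... | _ = + 0

fω : ℕ → ℤ
fω D with D % 4
... | 1 = + (D ℕ./ 4)      -- = (D - 1)/4 since D ≡ 1 mod 4
... | _ = + D

module _ (D : ℕ) where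

  addO : OK → OK → OK
  addO (a + b ω) (c + d ω) = (a + c) + (b + d) ω

  negO : OK → OK
  negO (a + b ω) = (- a) + (- b) ω

  subO : OK → OK → OK
  subO x y = addO x (negO y)

  mulO : OK → OK → OK
  mulO (a + b ω) (c + d ω) =
    (a * c + b * d * fω D) + (a * d + b * c + b * d * eω D) ω

  zeroO : OK
  zeroO = (+ 0) + (+ 0) ω

  oneO : OK
  oneO = (+ 1) + (+ 0) ω

  fromℤ : ℤ → OK
  fromℤ a = a + (+ 0) ω

  powO : OK → ℕ → OK
  powO x zero = oneO
  powO x (suc n) = mulO x (powO x n)

  -- Galois conjugation: ω ↦ e - ω  (i.e. √D ↦ -√D)
  conjO : OK → OK
  conjO (a + b ω) = (a + b * eω D) + (- b) ω

  IsUnit : OK → Set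
  IsUnit t = Σ OK λ u → mulO t u ≡ oneO

  record Ideal : Set₁ where
    field
      mem     : OK → Set
      mem-0   : mem zeroO
      mem-+   : ∀ {x y} → mem x → mem y → mem (addO x y)
      mem-mul : ∀ r {x} → mem x → mem (mulO r x)
  open Ideal public

  sumProd : List (OK × OK) → OK
  sumProd [] = zeroO
  sumProd ((a , b) ∷ l) = addO (mulO a b) (sumProd l)

  AllPairs : (OK → Set) → (OK → Set) → List (OK × OK) → Set
  AllPairs I J [] = Data.Unit.⊤
    where import Data.Unit
  AllPairs I J ((a , b) ∷ l) = I a × J b × AllPairs I J l

  ProdMem : (OK → Set) → (OK → Set) → OK → Set
  ProdMem I J x = Σ (List (OK × OK)) λ l → AllPairs I J l × x ≡ sumProd l

  PrincMem : ℤ → OK → Set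
  PrincMem n x = Σ OK λ y → x ≡ mulO (fromℤ n) y

  ConjMem : Ideal → OK → Set
  ConjMem P x = mem P (conjO x)

  IsPrimeIdeal : Ideal → Set
  IsPrimeIdeal P = ¬ mem P oneO × (∀ a b → mem P (mulO a b) → mem P a ⊎ mem P b)

  SameIdeal : (OK → Set) → (OK → Set) → Set
  SameIdeal I J = ∀ x → (I x → J x) × (J x → I x)

  SplitsAs : ℕ → Ideal → Set
  SplitsAs p P =
    IsPrimeIdeal P
    × ¬ SameIdeal (mem P) (ConjMem P)
    × SameIdeal (PrincMem (+ p)) (ProdMem (mem P) (ConjMem P))

  CongModSq : (OK → Set) → OK → OK → Set
  CongModSq I x y = ProdMem I I (subO x y)

-- Let x = t^(p-1). As N(t) = ±1 and p - 1 is even, x x̄ = N(t)^(p-1) = 1. Conjugation maps 𝔭²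
-- onto 𝔭̄², and -x · conj(x - 1) = -x x̄ + x = x - 1, so x ≡ 1 mod 𝔭² iff x ≡ 1 mod 𝔭̄².
-- Since p ∈ 𝔭̄, p²O ⊆ 𝔭̄². Conversely 𝔭 and 𝔭̄ are comaximal, u + v = 1 with u ∈ 𝔭, v ∈ 𝔭̄; if
-- y ∈ 𝔭² ∩ 𝔭̄² then u²y and v²y lie in (𝔭𝔭̄)² = p²O, hence so does y = (u + v)³ y.
-- Comaximality: write p = Σ aᵢbᵢ with aᵢ ∈ 𝔭, bᵢ ∈ 𝔭̄. An aᵢ whose trace is prime to p gives
-- k·tr(aᵢ) + m·p = 1, i.e. (k aᵢ + m p) + k āᵢ = 1. Otherwise use tr(a)² = disc·b² + 4 N(a)
-- for a = a₀ + bω, and p | N(a) for a ∈ 𝔭 (as a ā ∈ 𝔭𝔭̄ = pO): if p | disc, every element of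
-- 𝔭 has trace divisible by p, so 𝔭 is stable under conjugation and 𝔭 = 𝔭̄; if p ∤ disc,
-- every aᵢ is divisible by p, so p ∈ p𝔭̄ and 1 ∈ 𝔭̄. Both contradict the splitting.

module Submission where

open import Defs
open import Algebra.Bundles using (CommutativeRing)
open import Algebra.Consequences.Propositional
  using (comm∧idˡ⇒id; comm∧invˡ⇒inv; comm∧distrˡ⇒distr)
open import Tactic.RingSolver.Core.AlmostCommutativeRing
  using (AlmostCommutativeRing; fromCommutativeRing)
import Tactic.RingSolver as RingSolver
import Algebra.Properties.CommutativeSemigroup as CommutativeSemigroupProperties
import Algebra.Properties.Ring as RingProperties

open import Data.Integer as ℤ using (ℤ; +_; -[1+_]; _+_; _*_; -_; _-_)
import Data.Integer.Properties as ℤ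
open import Data.Integer.Divisibility.Signed
  using (_∣_; divides; _∣?_; ∣ᵤ⇒∣; ∣⇒∣ᵤ; ∣m∣n⇒∣m+n; ∣m+n∣n⇒∣m; ∣m⇒∣m*n; ∣n⇒∣m*n)
open import Data.Integer.Tactic.RingSolver using (solve-∀)
open import Data.Nat as ℕ using (ℕ)
import Data.Nat.Properties as ℕ
open import Data.Nat.Divisibility using () renaming (_∣_ to _∣ℕ_)
open import Data.Nat.DivMod using (m≡m%n+[m/n]*n)
open import Data.Nat.Coprimality using (Coprime; coprime-Bézout)
open import Data.Nat.GCD using (module Bézout)
open import Data.Nat.Primality using (Prime; euclidsLemma; prime⇒irreducible; prime⇒nonZero)
open import Data.Product using (Σ; ∃₂; _×_; _,_; proj₁; proj₂)
open import Data.List using ([]; _∷_; _++_)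
open import Data.Unit using (tt)
open import Data.Sum using (_⊎_; inj₁; inj₂; [_,_]′)
open import Data.Empty using (⊥-elim)
open import Function using (id; _∘_)
open import Function.Bundles using (_⇔_; mk⇔)
open import Relation.Nullary using (¬_; yes; no)
open import Relation.Unary using (Decidable)
open import Relation.Binary.Definitions using (DecidableEquality)
open import Relation.Nullary.Decidable using (map′; _×-dec_; dec⇒maybe)
open import Relation.Binary.PropositionalEquality
open import Algebra.Definitions {A = OK} (_≡_)
  using (Associative; Commutative; LeftIdentity; LeftInverse; _DistributesOverˡ_)

module _ {p : ℕ} (p-prime : Prime p) where

  prime-∣-* : ∀ m n → + p ∣ m * n → + p ∣ m ⊎ + p ∣ n
  prime-∣-* m n p∣mn
    with euclidsLemma ℤ.∣ m ∣ ℤ.∣ n ∣ p-prime (subst (p ∣ℕ_) (ℤ.abs-* m n) (∣⇒∣ᵤ p∣mn))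
  ... | inj₁ p∣m = inj₁ (∣ᵤ⇒∣ p∣m)
  ... | inj₂ p∣n = inj₂ (∣ᵤ⇒∣ p∣n)

  prime-∣-square : ∀ m → + p ∣ m * m → + p ∣ m
  prime-∣-square m p∣m² = [ id , id ]′ (prime-∣-* m m p∣m²)

  private
    pos-1+*≡* : ∀ a b c d → 1 ℕ.+ a ℕ.* b ≡ c ℕ.* d → + 1 + + a * + b ≡ + c * + d
    pos-1+*≡* a b c d eq = begin
      + 1 + + a * + b   ≡⟨ cong (_+_ (+ 1)) (ℤ.pos-* a b) ⟨
      + 1 + + (a ℕ.* b) ≡⟨ ℤ.pos-+ 1 (a ℕ.* b) ⟨
      + (1 ℕ.+ a ℕ.* b) ≡⟨ cong +_ eq ⟩
      + (c ℕ.* d)       ≡⟨ ℤ.pos-* c d ⟩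
      + c * + d         ∎
      where open ≡-Reasoning

  prime-∤⇒bézout : ∀ n → ¬ (+ p ∣ n) → ∃₂ λ k m → k * n + m * + p ≡ + 1
  prime-∤⇒bézout (+ n) p∤n = natural-bézout (coprime-Bézout coprime)
    where
    coprime : Coprime p n
    coprime (d∣p , d∣n) with prime⇒irreducible p-prime d∣p
    ... | inj₁ d≡1 = d≡1
    ... | inj₂ refl = ⊥-elim (p∤n (∣ᵤ⇒∣ d∣n))
    natural-bézout : Bézout.Identity 1 p n → ∃₂ λ k m → k * + n + m * + p ≡ + 1
    natural-bézout (Bézout.+- x y eq) =
      - + y , + x , trans (cong (_+_ (- + y * + n)) (sym (pos-1+*≡* y n x p eq))) (cancel (+ y) (+ n))
      where
      cancel : ∀ a b → - a * b + (+ 1 + a * b) ≡ + 1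
      cancel = solve-∀
    natural-bézout (Bézout.-+ x y eq) =
      + y , - + x , trans (cong (_+ - + x * + p) (sym (pos-1+*≡* x p y n eq))) (cancel (+ x) (+ p))
      where
      cancel : ∀ a b → + 1 + a * b + - a * b ≡ + 1
      cancel = solve-∀

  prime-∤⇒bézout -[1+ n ] p∤n with prime-∤⇒bézout (+ ℕ.suc n) (p∤n ∘ ∣ᵤ⇒∣ ∘ ∣⇒∣ᵤ)
  ... | k , m , eq = - k , m , trans (cong (_+ m * + p) (neg-* k (+ ℕ.suc n))) eq
    where
    neg-* : ∀ a b → - a * - b ≡ a * b
    neg-* = solve-∀

*≡1⇒square≡1 : ∀ a b → a * b ≡ + 1 → a * a ≡ + 1
*≡1⇒square≡1 a b ab≡1
  with ℕ.m*n≡1⇒m≡1 ℤ.∣ a ∣ ℤ.∣ b ∣ (trans (sym (ℤ.abs-* a b)) (cong ℤ.∣_∣ ab≡1))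
*≡1⇒square≡1 (+ .1)     b ab≡1 | refl = refl
*≡1⇒square≡1 -[1+ .0 ] b ab≡1 | refl = refl

module QuadraticIntegers (D : ℕ) where

  infixl 6 _⊞_
  infixl 7 _⊠_

  _⊞_ _⊠_ : OK → OK → OK
  _⊞_ = addO D
  _⊠_ = mulO D

  private
    e f : ℤ
    e = eω D
    f = fω D

  ⊞-assoc : Associative _⊞_
  ⊞-assoc (a + b ω) (c + d ω) (g + h ω) = cong₂ _+_ω (ℤ.+-assoc a c g) (ℤ.+-assoc b d h)

  ⊞-comm : Commutative _⊞_
  ⊞-comm (a + b ω) (c + d ω) = cong₂ _+_ω (ℤ.+-comm a c) (ℤ.+-comm b d)

  ⊞-identityˡ : LeftIdentity (zeroO D) _⊞_
  ⊞-identityˡ (a + b ω) = cong₂ _+_ω (ℤ.+-identityˡ a) (ℤ.+-identityˡ b)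

  ⊞-inverseˡ : LeftInverse (zeroO D) (negO D) _⊞_
  ⊞-inverseˡ (a + b ω) = cong₂ _+_ω (ℤ.+-inverseˡ a) (ℤ.+-inverseˡ b)

  ⊠-comm : Commutative _⊠_
  ⊠-comm (a + b ω) (c + d ω) = cong₂ _+_ω (re-comm a b c d f) (im-comm a b c d e)
    where
    re-comm : ∀ a b c d f → a * c + b * d * f ≡ c * a + d * b * f
    re-comm = solve-∀
    im-comm : ∀ a b c d e → a * d + b * c + b * d * e ≡ c * b + d * a + d * b * e
    im-comm = solve-∀

  ⊠-assoc : Associative _⊠_
  ⊠-assoc (a + b ω) (c + d ω) (g + h ω) =
    cong₂ _+_ω (re-assoc a b c d g h e f) (im-assoc a b c d g h e f)
    where
    re-assoc : ∀ a b c d g h e f →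
      (a * c + b * d * f) * g + (a * d + b * c + b * d * e) * h * f
        ≡ a * (c * g + d * h * f) + b * (c * h + d * g + d * h * e) * f
    re-assoc = solve-∀
    im-assoc : ∀ a b c d g h e f →
      (a * c + b * d * f) * h + (a * d + b * c + b * d * e) * g
        + (a * d + b * c + b * d * e) * h * e
        ≡ a * (c * h + d * g + d * h * e) + b * (c * g + d * h * f)
          + b * (c * h + d * g + d * h * e) * e
    im-assoc = solve-∀

  ⊠-identityˡ : LeftIdentity (oneO D) _⊠_
  ⊠-identityˡ (a + b ω) = cong₂ _+_ω (re-identity a b f) (im-identity a b e)
    where
    re-identity : ∀ a b f → + 1 * a + + 0 * b * f ≡ a
    re-identity = solve-∀
    im-identity : ∀ a b e → + 1 * b + + 0 * a + + 0 * b * e ≡ b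
    im-identity = solve-∀

  ⊠-distribˡ-⊞ : _⊠_ DistributesOverˡ _⊞_
  ⊠-distribˡ-⊞ (a + b ω) (c + d ω) (g + h ω) =
    cong₂ _+_ω (re-distrib a b c d g h f) (im-distrib a b c d g h e)
    where
    re-distrib : ∀ a b c d g h f →
      a * (c + g) + b * (d + h) * f ≡ (a * c + b * d * f) + (a * g + b * h * f)
    re-distrib = solve-∀
    im-distrib : ∀ a b c d g h e →
      a * (d + h) + b * (c + g) + b * (d + h) * e
        ≡ (a * d + b * c + b * d * e) + (a * h + b * g + b * h * e)
    im-distrib = solve-∀

  commutativeRing : CommutativeRing _ _
  commutativeRing = record
    { Carrier = OK ; _≈_ = _≡_ ; _+_ = _⊞_ ; _*_ = _⊠_ ; -_ = negO D
    ; 0# = zeroO D ; 1# = oneO D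
    ; isCommutativeRing = record
      { isRing = record
        { +-isAbelianGroup = record
          { isGroup = record
            { isMonoid = record
              { isSemigroup = record
                { isMagma = record { isEquivalence = isEquivalence ; ∙-cong = cong₂ _⊞_ }
                ; assoc = ⊞-assoc }
              ; identity = comm∧idˡ⇒id ⊞-comm ⊞-identityˡ }
            ; inverse = comm∧invˡ⇒inv ⊞-comm ⊞-inverseˡ
            ; ⁻¹-cong = cong (negO D) }
          ; comm = ⊞-comm }
        ; *-cong = cong₂ _⊠_
        ; *-assoc = ⊠-assoc
        ; *-identity = comm∧idˡ⇒id ⊠-comm ⊠-identityˡ
        ; distrib = comm∧distrˡ⇒distr (cong₂ _⊞_) ⊠-comm ⊠-distribˡ-⊞ }
      ; *-comm = ⊠-comm } }

  open CommutativeRing commutativeRing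
    using (+-identityʳ; *-identityʳ; zeroʳ; distribˡ; *-commutativeSemigroup)
  open CommutativeSemigroupProperties *-commutativeSemigroup
    using () renaming (interchange to ⊠-interchange; x∙yz≈y∙xz to ⊠-leftComm)
  open RingProperties (CommutativeRing.ring commutativeRing) using (-1*x≈-x)

  _≟_ : DecidableEquality OK
  (a + b ω) ≟ (c + d ω) =
    map′ (λ (a≡c , b≡d) → cong₂ _+_ω a≡c b≡d) (λ eq → cong re eq , cong im eq) (a ℤ.≟ c ×-dec b ℤ.≟ d)

  OK-ring : AlmostCommutativeRing _ _
  OK-ring = fromCommutativeRing commutativeRing (λ x → dec⇒maybe (zeroO D ≟ x))

  infix  8 ⊟_
  infixl 6 _⊟_
  infixr 8 _^_

  ⊟_ : OK → OK
  ⊟_ = negO D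

  _⊟_ : OK → OK → OK
  _⊟_ = subO D

  _^_ : OK → ℕ → OK
  _^_ = powO D

  0O 1O : OK
  0O = zeroO D
  1O = oneO D

  ι : ℤ → OK
  ι = fromℤ D

  conj : OK → OK
  conj = conjO D

  ι-⊠ : ∀ a b → ι a ⊠ ι b ≡ ι (a * b)
  ι-⊠ a b = cong₂ _+_ω (re-eq a b f) (im-eq a b e)
    where
    re-eq : ∀ a b f → a * b + + 0 * + 0 * f ≡ a * b
    re-eq = solve-∀
    im-eq : ∀ a b e → a * + 0 + + 0 * b + + 0 * + 0 * e ≡ + 0
    im-eq = solve-∀

  ι-⊠ˡ : ∀ q x → ι q ⊠ x ≡ (q * re x) + (q * im x) ω
  ι-⊠ˡ q (c + d ω) = cong₂ _+_ω (re-eq q c d f) (im-eq q c d e)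
    where
    re-eq : ∀ q c d f → q * c + + 0 * d * f ≡ q * c
    re-eq = solve-∀
    im-eq : ∀ q c d e → q * d + + 0 * c + + 0 * d * e ≡ q * d
    im-eq = solve-∀

  conj-⊞ : ∀ x y → conj (x ⊞ y) ≡ conj x ⊞ conj y
  conj-⊞ (a + b ω) (c + d ω) = cong₂ _+_ω (re-eq a b c d e) (ℤ.neg-distrib-+ b d)
    where
    re-eq : ∀ a b c d e → (a + c) + (b + d) * e ≡ (a + b * e) + (c + d * e)
    re-eq = solve-∀

  conj-⊠ : ∀ x y → conj (x ⊠ y) ≡ conj x ⊠ conj y
  conj-⊠ (a + b ω) (c + d ω) = cong₂ _+_ω (re-eq a b c d e f) (im-eq a b c d e)
    where
    re-eq : ∀ a b c d e f →
      (a * c + b * d * f) + (a * d + b * c + b * d * e) * e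
        ≡ (a + b * e) * (c + d * e) + (- b) * (- d) * f
    re-eq = solve-∀
    im-eq : ∀ a b c d e →
      - (a * d + b * c + b * d * e)
        ≡ (a + b * e) * (- d) + (- b) * (c + d * e) + (- b) * (- d) * e
    im-eq = solve-∀

  conj-involutive : ∀ x → conj (conj x) ≡ x
  conj-involutive (a + b ω) = cong₂ _+_ω (re-eq a b e) (ℤ.neg-involutive b)
    where
    re-eq : ∀ a b e → (a + b * e) + (- b) * e ≡ a
    re-eq = solve-∀

  norm trace : OK → ℤ
  norm  x = re (x ⊠ conj x)
  trace x = re (x ⊞ conj x)

  ⊠-conj≡norm : ∀ x → x ⊠ conj x ≡ ι (norm x)
  ⊠-conj≡norm (a + b ω) = cong₂ _+_ω refl (im-eq a b e)
    where
    im-eq : ∀ a b e → a * (- b) + b * (a + b * e) + b * (- b) * e ≡ + 0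
    im-eq = solve-∀

  ⊞-conj≡trace : ∀ x → x ⊞ conj x ≡ ι (trace x)
  ⊞-conj≡trace (a + b ω) = cong₂ _+_ω refl (ℤ.+-inverseʳ b)

  norm-⊠ : ∀ x y → norm (x ⊠ y) ≡ norm x * norm y
  norm-⊠ x y = cong re (begin
    ι (norm (x ⊠ y))               ≡⟨ ⊠-conj≡norm (x ⊠ y) ⟨
    x ⊠ y ⊠ conj (x ⊠ y)           ≡⟨ cong (x ⊠ y ⊠_) (conj-⊠ x y) ⟩
    x ⊠ y ⊠ (conj x ⊠ conj y)      ≡⟨ ⊠-interchange x y (conj x) (conj y) ⟩
    x ⊠ conj x ⊠ (y ⊠ conj y)      ≡⟨ cong₂ _⊠_ (⊠-conj≡norm x) (⊠-conj≡norm y) ⟩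
    ι (norm x) ⊠ ι (norm y)        ≡⟨ ι-⊠ (norm x) (norm y) ⟩
    ι (norm x * norm y)            ∎)
    where open ≡-Reasoning

  ^-+ : ∀ x m n → x ^ (m ℕ.+ n) ≡ x ^ m ⊠ x ^ n
  ^-+ x ℕ.zero    n = sym (⊠-identityˡ _)
  ^-+ x (ℕ.suc m) n = trans (cong (x ⊠_) (^-+ x m n)) (sym (⊠-assoc x _ _))

  ^-distrib-⊠ : ∀ x y n → (x ⊠ y) ^ n ≡ x ^ n ⊠ y ^ n
  ^-distrib-⊠ x y ℕ.zero    = sym (⊠-identityˡ 1O)
  ^-distrib-⊠ x y (ℕ.suc n) = trans (cong (x ⊠ y ⊠_) (^-distrib-⊠ x y n)) (⊠-interchange x y _ _)

  1^n≡1 : ∀ n → 1O ^ n ≡ 1O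
  1^n≡1 ℕ.zero    = refl
  1^n≡1 (ℕ.suc n) = trans (⊠-identityˡ _) (1^n≡1 n)

  conj-^ : ∀ x n → conj (x ^ n) ≡ conj x ^ n
  conj-^ x ℕ.zero    = refl
  conj-^ x (ℕ.suc n) = trans (conj-⊠ x (x ^ n)) (cong (conj x ⊠_) (conj-^ x n))

  unit⇒norm²≡1 : ∀ t → IsUnit D t → norm t * norm t ≡ + 1
  unit⇒norm²≡1 t (u , tu≡1) =
    *≡1⇒square≡1 (norm t) (norm u) (trans (sym (norm-⊠ t u)) (cong norm tu≡1))

  unit⇒even-power-⊠-conj≡1 : ∀ {t} → IsUnit D t → ∀ k →
                              t ^ (k ℕ.+ k) ⊠ conj (t ^ (k ℕ.+ k)) ≡ 1O
  unit⇒even-power-⊠-conj≡1 {t} t-unit k = begin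
    t ^ (k ℕ.+ k) ⊠ conj (t ^ (k ℕ.+ k))  ≡⟨ cong (t ^ (k ℕ.+ k) ⊠_) (conj-^ t (k ℕ.+ k)) ⟩
    t ^ (k ℕ.+ k) ⊠ conj t ^ (k ℕ.+ k)    ≡⟨ ^-distrib-⊠ t (conj t) (k ℕ.+ k) ⟨
    (t ⊠ conj t) ^ (k ℕ.+ k)              ≡⟨ cong (_^ (k ℕ.+ k)) (⊠-conj≡norm t) ⟩
    ι (norm t) ^ (k ℕ.+ k)                ≡⟨ ^-+ (ι (norm t)) k k ⟩
    ι (norm t) ^ k ⊠ ι (norm t) ^ k       ≡⟨ ^-distrib-⊠ (ι (norm t)) (ι (norm t)) k ⟨
    (ι (norm t) ⊠ ι (norm t)) ^ k         ≡⟨ cong (_^ k) (ι-⊠ (norm t) (norm t)) ⟩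
    ι (norm t * norm t) ^ k               ≡⟨ cong (λ n → ι n ^ k) (unit⇒norm²≡1 t t-unit) ⟩
    1O ^ k                                ≡⟨ 1^n≡1 k ⟩
    1O                                    ∎
    where open ≡-Reasoning

  ι-⊠-cancelˡ : ∀ q .{{_ : ℤ.NonZero q}} x y → ι q ⊠ x ≡ ι q ⊠ y → x ≡ y
  ι-⊠-cancelˡ q x y eq =
    cong₂ _+_ω (ℤ.*-cancelˡ-≡ q _ _ (cong re eq′)) (ℤ.*-cancelˡ-≡ q _ _ (cong im eq′))
    where
    eq′ : (q * re x) + (q * im x) ω ≡ (q * re y) + (q * im y) ω
    eq′ = trans (sym (ι-⊠ˡ q x)) (trans eq (ι-⊠ˡ q y))

  disc : ℤ
  disc = e * e + + 4 * f

  trace² : ∀ x → trace x * trace x ≡ disc * (im x * im x) + + 4 * norm x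
  trace² (a + b ω) = identity a b e f
    where
    identity : ∀ a b e f → (a + (a + b * e)) * (a + (a + b * e))
               ≡ (e * e + + 4 * f) * (b * b) + + 4 * (a * (a + b * e) + b * (- b) * f)
    identity = solve-∀

  re² : ∀ x → re x * re x ≡ norm x + im x * (im x * f - re x * e)
  re² (a + b ω) = identity a b e f
    where
    identity : ∀ a b e f → a * a ≡ (a * (a + b * e) + b * (- b) * f) + b * (b * f - a * e)
    identity = solve-∀

  private variable
    A A′ B B′ : OK → Set
    x y : OK

  prodMem-0 : ProdMem D A B 0O
  prodMem-0 = [] , tt , refl

  prodMem-⊠ : ∀ {a b} → A a → B b → ProdMem D A B (a ⊠ b)
  prodMem-⊠ {a = a} {b = b} Aa Bb = (a , b) ∷ [] , (Aa , Bb , tt) , sym (+-identityʳ (a ⊠ b))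

  prodMem-⊞ : ProdMem D A B x → ProdMem D A B y → ProdMem D A B (x ⊞ y)
  prodMem-⊞ (l , Al , refl) (l′ , Al′ , refl) =
    l ++ l′ , allPairs-++ l Al Al′ , sym (sumProd-++ l l′)
    where
    allPairs-++ : ∀ l {l′} → AllPairs D A B l → AllPairs D A B l′ → AllPairs D A B (l ++ l′)
    allPairs-++ []      _              Al′ = Al′
    allPairs-++ (_ ∷ l) (Aa , Bb , Al) Al′ = Aa , Bb , allPairs-++ l Al Al′
    sumProd-++ : ∀ l l′ → sumProd D (l ++ l′) ≡ sumProd D l ⊞ sumProd D l′
    sumProd-++ []            l′ = sym (⊞-identityˡ _)
    sumProd-++ ((a , b) ∷ l) l′ =
      trans (cong (a ⊠ b ⊞_) (sumProd-++ l l′)) (sym (⊞-assoc (a ⊠ b) (sumProd D l) (sumProd D l′)))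

  prodMem-elim : {C : OK → Set} → C 0O → (∀ {x y} → C x → C y → C (x ⊞ y)) →
                 (∀ {a b} → A a → B b → C (a ⊠ b)) → ProdMem D A B x → C x
  prodMem-elim         C0 C⊞ C⊠ ([] , _ , refl) = C0
  prodMem-elim {C = C} C0 C⊞ C⊠ ((a , b) ∷ l , (Aa , Bb , Al) , refl) =
    C⊞ {a ⊠ b} {sumProd D l} (C⊠ Aa Bb) (prodMem-elim {C = C} C0 C⊞ C⊠ (l , Al , refl))

  prodMem-split : {Q : OK → Set} → Decidable Q → ProdMem D A B x →
                  (Σ OK λ a → A a × ¬ Q a) ⊎ ProdMem D (λ a → A a × Q a) B x
  prodMem-split Q? ([] , _ , refl) = inj₂ prodMem-0
  prodMem-split Q? ((a , b) ∷ l , (Aa , Bb , Al) , refl) with Q? a | prodMem-split Q? (l , Al , refl)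
  ... | no ¬Qa | _           = inj₁ (a , Aa , ¬Qa)
  ... | yes _  | inj₁ found  = inj₁ found
  ... | yes Qa | inj₂ ∈rest  = inj₂ (prodMem-⊞ (prodMem-⊠ (Aa , Qa) Bb) ∈rest)

  prodMem-monoˡ : (∀ {a} → A a → A′ a) → ProdMem D A B x → ProdMem D A′ B x
  prodMem-monoˡ A⊆A′ = prodMem-elim prodMem-0 prodMem-⊞ (λ Aa Bb → prodMem-⊠ (A⊆A′ Aa) Bb)

  prodMem-conj : (∀ {a} → A a → A′ (conj a)) → (∀ {b} → B b → B′ (conj b)) →
                 ProdMem D A B x → ProdMem D A′ B′ (conj x)
  prodMem-conj {A′ = A′} {B′ = B′} conjA conjB = prodMem-elim prodMem-0
    (λ {x} {y} x∈ y∈ → subst (ProdMem D A′ B′) (sym (conj-⊞ x y)) (prodMem-⊞ x∈ y∈))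
    (λ {a} {b} Aa Bb → subst (ProdMem D A′ B′) (sym (conj-⊠ a b)) (prodMem-⊠ (conjA Aa) (conjB Bb)))

  prodMem-⊠ˡ : (∀ r {a} → A a → A (r ⊠ a)) →
               ∀ r → ProdMem D A B x → ProdMem D A B (r ⊠ x)
  prodMem-⊠ˡ {A = A} {B = B} A-mul r = prodMem-elim
    (subst (ProdMem D A B) (sym (zeroʳ r)) prodMem-0)
    (λ {x} {y} x∈ y∈ → subst (ProdMem D A B) (sym (distribˡ r x y)) (prodMem-⊞ x∈ y∈))
    (λ {a} {b} Aa Bb → subst (ProdMem D A B) (⊠-assoc r a b) (prodMem-⊠ (A-mul r Aa) Bb))

  prodMem⊆ : (I : Ideal D) → (∀ {a b} → A a → B b → mem I (a ⊠ b)) →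
             ProdMem D A B x → mem I x
  prodMem⊆ I = prodMem-elim (mem-0 I) (mem-+ I)

  conjIdeal : Ideal D → Ideal D
  conjIdeal I = record
    { mem     = ConjMem D I
    ; mem-0   = mem-0 I
    ; mem-+   = λ {x} {y} x∈ y∈ → subst (mem I) (sym (conj-⊞ x y)) (mem-+ I x∈ y∈)
    ; mem-mul = λ r {x} x∈ → subst (mem I) (sym (conj-⊠ r x)) (mem-mul I (conj r) x∈)
    }

  principal : ℤ → Ideal D
  principal q = record
    { mem     = PrincMem D q
    ; mem-0   = 0O , sym (zeroʳ (ι q))
    ; mem-+   = λ { (w , refl) (w′ , refl) → w ⊞ w′ , sym (distribˡ (ι q) w w′) }
    ; mem-mul = λ { r (w , refl) → r ⊠ w , ⊠-leftComm r (ι q) w }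
    }

  Comaximal : Ideal D → Ideal D → Set
  Comaximal I J = Σ OK λ u → Σ OK λ v → mem I u × mem J v × u ⊞ v ≡ 1O

  mem-⊟ : (I : Ideal D) → mem I x → mem I (⊟ x)
  mem-⊟ {x = x} I x∈I = subst (mem I) (-1*x≈-x x) (mem-mul I (⊟ 1O) x∈I)

  principal-⊠ : ∀ {q q′} → PrincMem D q x → PrincMem D q′ y → PrincMem D (q * q′) (x ⊠ y)
  principal-⊠ {q = q} {q′} (w , refl) (w′ , refl) =
    w ⊠ w′ , trans (⊠-interchange (ι q) w (ι q′) w′) (cong (_⊠ (w ⊠ w′)) (ι-⊠ q q′))

  principal⇒∣ : ∀ {q n} → PrincMem D q (ι n) → q ∣ n
  principal⇒∣ {q} (w , eq) =
    divides (re w) (trans (cong re (trans eq (ι-⊠ˡ q w))) (ℤ.*-comm q (re w)))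

  ∣⇒principal : ∀ {q} → q ∣ re x → q ∣ im x → PrincMem D q x
  ∣⇒principal {q = q} (divides k refl) (divides l refl) =
    k + l ω , trans (cong₂ _+_ω (ℤ.*-comm k q) (ℤ.*-comm l q)) (sym (ι-⊠ˡ q (k + l ω)))

  prodMem-principalˡ : ∀ q (J : Ideal D) → ProdMem D (PrincMem D q) (mem J) x →
                       Σ OK λ w → mem J w × x ≡ ι q ⊠ w
  prodMem-principalˡ q J = prodMem-elim {C = λ z → Σ OK λ w → mem J w × z ≡ ι q ⊠ w}
    (0O , mem-0 J , sym (zeroʳ (ι q)))
    (λ { (w , w∈J , refl) (w′ , w′∈J , refl) →
           w ⊞ w′ , mem-+ J w∈J w′∈J , sym (distribˡ (ι q) w w′) })
    (λ { (w , refl) b∈J → w ⊠ _ , mem-mul J w b∈J , ⊠-assoc (ι q) w _ })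

  congModSq-conj : (I J : Ideal D) → (∀ {a} → mem I a → mem J (conj a)) →
                   ∀ x → x ⊠ conj x ≡ 1O → CongModSq D (mem I) x 1O → CongModSq D (mem J) x 1O
  congModSq-conj I J conj-I⊆J x x⊠conj-x≡1 x≡1 =
    subst (ProdMem D (mem J) (mem J)) ⊟x⊠conj[x⊟1]≡x⊟1
      (prodMem-⊠ˡ (mem-mul J) (⊟ x) (prodMem-conj conj-I⊆J conj-I⊆J x≡1))
    where
    ⊟x⊠conj[x⊟1]≡x⊟1 : ⊟ x ⊠ conj (x ⊟ 1O) ≡ x ⊟ 1O
    ⊟x⊠conj[x⊟1]≡x⊟1 = begin
      ⊟ x ⊠ conj (x ⊟ 1O)    ≡⟨ cong (⊟ x ⊠_) (conj-⊞ x (⊟ 1O)) ⟩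
      ⊟ x ⊠ (conj x ⊟ 1O)    ≡⟨ expand x (conj x) ⟩
      x ⊟ x ⊠ conj x         ≡⟨ cong (_⊟_ x) x⊠conj-x≡1 ⟩
      x ⊟ 1O                 ∎
      where
      open ≡-Reasoning
      expand : ∀ x c → ⊟ x ⊠ (c ⊟ 1O) ≡ x ⊟ x ⊠ c
      expand = RingSolver.solve-∀ OK-ring

  principal-square⊆square : ∀ q (J : Ideal D) → mem J (ι q) →
                            PrincMem D (q * q) x → ProdMem D (mem J) (mem J) x
  principal-square⊆square q J q∈J (w , refl) =
    subst (ProdMem D (mem J) (mem J)) q⊠[w⊠q]≡[q*q]⊠w (prodMem-⊠ q∈J (mem-mul J w q∈J))
    where
    q⊠[w⊠q]≡[q*q]⊠w : ι q ⊠ (w ⊠ ι q) ≡ ι (q * q) ⊠ w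
    q⊠[w⊠q]≡[q*q]⊠w = begin
      ι q ⊠ (w ⊠ ι q)   ≡⟨ ⊠-leftComm (ι q) w (ι q) ⟩
      w ⊠ (ι q ⊠ ι q)   ≡⟨ ⊠-comm w _ ⟩
      ι q ⊠ ι q ⊠ w     ≡⟨ cong (_⊠ w) (ι-⊠ q q) ⟩
      ι (q * q) ⊠ w     ∎
      where open ≡-Reasoning

  prodMem-scale² : ∀ q s → (∀ {a} → A a → PrincMem D q (s ⊠ a)) →
                   ProdMem D A A x → PrincMem D (q * q) (s ⊠ s ⊠ x)
  prodMem-scale² q s sA⊆qO = prodMem-elim {C = λ z → PrincMem D (q * q) (s ⊠ s ⊠ z)}
    (subst (PrincMem D (q * q)) (sym (zeroʳ (s ⊠ s))) (mem-0 (principal (q * q))))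
    (λ {x} {y} x∈ y∈ → subst (PrincMem D (q * q)) (sym (distribˡ (s ⊠ s) x y))
                                (mem-+ (principal (q * q)) x∈ y∈))
    (λ {a} {b} Aa Ab → subst (PrincMem D (q * q)) (⊠-interchange s a s b)
                              (principal-⊠ {q = q} {q} (sA⊆qO Aa) (sA⊆qO Ab)))

  comaximal⇒square∩square⊆principal² :
    ∀ q (I J : Ideal D) → Comaximal I J → (∀ {a b} → mem I a → mem J b → PrincMem D q (a ⊠ b)) →
    ProdMem D (mem I) (mem I) x → ProdMem D (mem J) (mem J) x → PrincMem D (q * q) x
  comaximal⇒square∩square⊆principal² {x = x} q I J (u , v , u∈I , v∈J , u⊞v≡1) IJ⊆qO x∈I² x∈J² =
    subst (PrincMem D (q * q)) (sym x≡)
      (mem-+ (principal (q * q)) (mem-mul (principal (q * q)) (u ⊞ v ⊞ v ⊞ v) u²x∈)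
                                 (mem-mul (principal (q * q)) (u ⊞ u ⊞ u ⊞ v) v²x∈))
    where
    u²x∈ : PrincMem D (q * q) (u ⊠ u ⊠ x)
    u²x∈ = prodMem-scale² q u (IJ⊆qO u∈I) x∈J²
    v²x∈ : PrincMem D (q * q) (v ⊠ v ⊠ x)
    v²x∈ = prodMem-scale² q v (λ {a} a∈I → subst (PrincMem D q) (⊠-comm a v) (IJ⊆qO a∈I v∈J)) x∈I²
    cube : ∀ u v x → (u ⊞ v) ⊠ ((u ⊞ v) ⊠ ((u ⊞ v) ⊠ x))
           ≡ (u ⊞ v ⊞ v ⊞ v) ⊠ (u ⊠ u ⊠ x) ⊞ (u ⊞ u ⊞ u ⊞ v) ⊠ (v ⊠ v ⊠ x)
    cube = RingSolver.solve-∀ OK-ring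
    x≡ : x ≡ (u ⊞ v ⊞ v ⊞ v) ⊠ (u ⊠ u ⊠ x) ⊞ (u ⊞ u ⊞ u ⊞ v) ⊠ (v ⊠ v ⊠ x)
    x≡ = begin
      x                                   ≡⟨ ⊠-identityˡ³ x ⟨
      1O ⊠ (1O ⊠ (1O ⊠ x))                ≡⟨ cong (λ w → w ⊠ (w ⊠ (w ⊠ x))) u⊞v≡1 ⟨
      (u ⊞ v) ⊠ ((u ⊞ v) ⊠ ((u ⊞ v) ⊠ x)) ≡⟨ cube u v x ⟩
      (u ⊞ v ⊞ v ⊞ v) ⊠ (u ⊠ u ⊠ x) ⊞ (u ⊞ u ⊞ u ⊞ v) ⊠ (v ⊠ v ⊠ x) ∎
      where
      open ≡-Reasoning
      ⊠-identityˡ³ : ∀ x → 1O ⊠ (1O ⊠ (1O ⊠ x)) ≡ x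
      ⊠-identityˡ³ = RingSolver.solve-∀ OK-ring

  conj≡ι-trace⊟ : ∀ x → conj x ≡ ι (trace x) ⊟ x
  conj≡ι-trace⊟ x = trans (cancel x (conj x)) (cong (_⊟ x) (⊞-conj≡trace x))
    where
    cancel : ∀ x c → c ≡ x ⊞ c ⊟ x
    cancel = RingSolver.solve-∀ OK-ring

  ∣trace⇒conj∈ : ∀ {q} (I : Ideal D) → mem I (ι q) → mem I x → q ∣ trace x → mem I (conj x)
  ∣trace⇒conj∈ {x = x} {q} I q∈I x∈I (divides k trace≡kq) =
    subst (mem I) (sym conj-x≡) (mem-+ I (mem-mul I (ι k) q∈I) (mem-⊟ I x∈I))
    where
    conj-x≡ : conj x ≡ ι k ⊠ ι q ⊟ x
    conj-x≡ = trans (conj≡ι-trace⊟ x) (cong (_⊟ x) (trans (cong ι trace≡kq) (sym (ι-⊠ k q))))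

  conj-closed⇒SameIdeal : (I : Ideal D) → (∀ {x} → mem I x → mem I (conj x)) →
                          SameIdeal D (mem I) (ConjMem D I)
  conj-closed⇒SameIdeal I closed x =
    closed , λ conj-x∈I → subst (mem I) (conj-involutive x) (closed conj-x∈I)

  trace-bézout⇒comaximal : ∀ {q a} (I : Ideal D) → mem I (ι q) → mem I a →
                           ∀ k m → k * trace a + m * q ≡ + 1 → Comaximal I (conjIdeal I)
  trace-bézout⇒comaximal {q} {a} I q∈I a∈I k m bézout =
    ι k ⊠ a ⊞ ι m ⊠ ι q , ι k ⊠ conj a ,
    mem-+ I (mem-mul I (ι k) a∈I) (mem-mul I (ι m) q∈I) ,
    mem-mul (conjIdeal I) (ι k) (subst (mem I) (sym (conj-involutive a)) a∈I) ,
    (begin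
      ι k ⊠ a ⊞ ι m ⊠ ι q ⊞ ι k ⊠ conj a  ≡⟨ regroup (ι k) a (conj a) (ι m) (ι q) ⟩
      ι k ⊠ (a ⊞ conj a) ⊞ ι m ⊠ ι q      ≡⟨ cong (λ z → ι k ⊠ z ⊞ ι m ⊠ ι q) (⊞-conj≡trace a) ⟩
      ι k ⊠ ι (trace a) ⊞ ι m ⊠ ι q       ≡⟨ cong₂ _⊞_ (ι-⊠ k (trace a)) (ι-⊠ m q) ⟩
      ι (k * trace a + m * q)             ≡⟨ cong ι bézout ⟩
      1O                                  ∎)
    where
    open ≡-Reasoning
    regroup : ∀ k a c m q → k ⊠ a ⊞ m ⊠ q ⊞ k ⊠ c ≡ k ⊠ (a ⊞ c) ⊞ m ⊠ q
    regroup = RingSolver.solve-∀ OK-ring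

  module _ {p : ℕ} (p-prime : Prime p) where

    ∣disc∧∣norm⇒∣trace : ∀ x → + p ∣ disc → + p ∣ norm x → + p ∣ trace x
    ∣disc∧∣norm⇒∣trace x p∣disc p∣norm = prime-∣-square p-prime (trace x)
      (subst (+ p ∣_) (sym (trace² x))
        (∣m∣n⇒∣m+n (∣m⇒∣m*n (im x * im x) p∣disc) (∣n⇒∣m*n (+ 4) p∣norm)))

    ∤disc∧∣trace∧∣norm⇒principal : ∀ x → ¬ (+ p ∣ disc) → + p ∣ trace x → + p ∣ norm x →
                                   PrincMem D (+ p) x
    ∤disc∧∣trace∧∣norm⇒principal x p∤disc p∣trace p∣norm = ∣⇒principal p∣re p∣im
      where
      p∣disc⊠im² : + p ∣ disc * (im x * im x)
      p∣disc⊠im² =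
        ∣m+n∣n⇒∣m (subst (+ p ∣_) (trace² x) (∣m⇒∣m*n (trace x) p∣trace)) (∣n⇒∣m*n (+ 4) p∣norm)
      p∣im : + p ∣ im x
      p∣im = [ ⊥-elim ∘ p∤disc , prime-∣-square p-prime (im x) ]′
               (prime-∣-* p-prime disc (im x * im x) p∣disc⊠im²)
      p∣re : + p ∣ re x
      p∣re = prime-∣-square p-prime (re x)
        (subst (+ p ∣_) (sym (re² x)) (∣m∣n⇒∣m+n p∣norm (∣m⇒∣m*n (im x * f - re x * e) p∣im)))

  module Splitting {p : ℕ} (p-prime : Prime p) (𝔭 : Ideal D) (split : SplitsAs D p 𝔭) where

    𝔭̄ : Ideal D
    𝔭̄ = conjIdeal 𝔭

    private
      1∉𝔭 : ¬ mem 𝔭 1O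
      1∉𝔭 = proj₁ (proj₁ split)

      𝔭≢𝔭̄ : ¬ SameIdeal D (mem 𝔭) (mem 𝔭̄)
      𝔭≢𝔭̄ = proj₁ (proj₂ split)

      p≡𝔭𝔭̄ : SameIdeal D (PrincMem D (+ p)) (ProdMem D (mem 𝔭) (mem 𝔭̄))
      p≡𝔭𝔭̄ = proj₂ (proj₂ split)

      instance
        p≢0 : ℕ.NonZero p
        p≢0 = prime⇒nonZero p-prime

    p∈𝔭𝔭̄ : ProdMem D (mem 𝔭) (mem 𝔭̄) (ι (+ p))
    p∈𝔭𝔭̄ = proj₁ (p≡𝔭𝔭̄ (ι (+ p))) (1O , sym (*-identityʳ (ι (+ p))))

    p∈𝔭 : mem 𝔭 (ι (+ p))
    p∈𝔭 = prodMem⊆ 𝔭 (λ {a} {b} a∈𝔭 _ → subst (mem 𝔭) (⊠-comm b a) (mem-mul 𝔭 b a∈𝔭)) p∈𝔭𝔭̄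

    p∈𝔭̄ : mem 𝔭̄ (ι (+ p))
    p∈𝔭̄ = prodMem⊆ 𝔭̄ (λ {a} _ b∈𝔭̄ → mem-mul 𝔭̄ a b∈𝔭̄) p∈𝔭𝔭̄

    𝔭𝔭̄⊆p : ∀ {a b} → mem 𝔭 a → mem 𝔭̄ b → PrincMem D (+ p) (a ⊠ b)
    𝔭𝔭̄⊆p {a} {b} a∈𝔭 b∈𝔭̄ = proj₂ (p≡𝔭𝔭̄ (a ⊠ b)) (prodMem-⊠ a∈𝔭 b∈𝔭̄)

    p∣norm : ∀ {a} → mem 𝔭 a → + p ∣ norm a
    p∣norm {a} a∈𝔭 = principal⇒∣ (subst (PrincMem D (+ p)) (⊠-conj≡norm a)
                                   (𝔭𝔭̄⊆p a∈𝔭 (subst (mem 𝔭) (sym (conj-involutive a)) a∈𝔭)))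

    ∣disc⇒𝔭≡𝔭̄ : + p ∣ disc → SameIdeal D (mem 𝔭) (mem 𝔭̄)
    ∣disc⇒𝔭≡𝔭̄ p∣disc = conj-closed⇒SameIdeal 𝔭 λ {x} x∈𝔭 →
      ∣trace⇒conj∈ 𝔭 p∈𝔭 x∈𝔭 (∣disc∧∣norm⇒∣trace p-prime x p∣disc (p∣norm x∈𝔭))

    ∤disc⇒comaximal : ¬ (+ p ∣ disc) → Comaximal 𝔭 𝔭̄
    ∤disc⇒comaximal p∤disc =
      [ trace-coprime , ⊥-elim ∘ 1∉𝔭 ∘ all-trace-divisible⇒1∈𝔭̄ ]′
        (prodMem-split (λ a → + p ∣? trace a) p∈𝔭𝔭̄)
      where
      trace-coprime : (Σ OK λ a → mem 𝔭 a × ¬ (+ p ∣ trace a)) → Comaximal 𝔭 𝔭̄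
      trace-coprime (a , a∈𝔭 , p∤trace) with prime-∤⇒bézout p-prime (trace a) p∤trace
      ... | k , m , bézout = trace-bézout⇒comaximal 𝔭 p∈𝔭 a∈𝔭 k m bézout

      all-trace-divisible⇒1∈𝔭̄ : ProdMem D (λ a → mem 𝔭 a × + p ∣ trace a) (mem 𝔭̄) (ι (+ p)) →
                                mem 𝔭̄ 1O
      all-trace-divisible⇒1∈𝔭̄ =
        p⊠w≡p⇒1∈𝔭̄ ∘ prodMem-principalˡ (+ p) 𝔭̄ ∘ prodMem-monoˡ ∣trace⇒principal
        where
        ∣trace⇒principal : ∀ {a} → mem 𝔭 a × + p ∣ trace a → PrincMem D (+ p) a
        ∣trace⇒principal {a} (a∈𝔭 , p∣trace) =
          ∤disc∧∣trace∧∣norm⇒principal p-prime a p∤disc p∣trace (p∣norm a∈𝔭)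
        p⊠w≡p⇒1∈𝔭̄ : (Σ OK λ w → mem 𝔭̄ w × ι (+ p) ≡ ι (+ p) ⊠ w) → mem 𝔭̄ 1O
        p⊠w≡p⇒1∈𝔭̄ (w , w∈𝔭̄ , p≡p⊠w) =
          subst (mem 𝔭̄) (ι-⊠-cancelˡ (+ p) w 1O (trans (sym p≡p⊠w) (sym (*-identityʳ (ι (+ p))))))
                w∈𝔭̄

    comaximal : Comaximal 𝔭 𝔭̄
    comaximal with + p ∣? disc
    ... | yes p∣disc = ⊥-elim (𝔭≢𝔭̄ (∣disc⇒𝔭≡𝔭̄ p∣disc))
    ... | no  p∤disc = ∤disc⇒comaximal p∤disc

odd⇒∸1≡half+half : ∀ n → n ℕ.% 2 ≡ 1 → n ℕ.∸ 1 ≡ n ℕ./ 2 ℕ.+ n ℕ./ 2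
odd⇒∸1≡half+half n n-odd = begin
  n ℕ.∸ 1                             ≡⟨ cong (ℕ._∸ 1) (m≡m%n+[m/n]*n n 2) ⟩
  (n ℕ.% 2 ℕ.+ n ℕ./ 2 ℕ.* 2) ℕ.∸ 1  ≡⟨ cong (λ r → (r ℕ.+ n ℕ./ 2 ℕ.* 2) ℕ.∸ 1) n-odd ⟩
  n ℕ./ 2 ℕ.* 2                       ≡⟨ ℕ.*-comm (n ℕ./ 2) 2 ⟩
  n ℕ./ 2 ℕ.+ (n ℕ./ 2 ℕ.+ 0)         ≡⟨ cong (n ℕ./ 2 ℕ.+_) (ℕ.+-identityʳ (n ℕ./ 2)) ⟩
  n ℕ./ 2 ℕ.+ n ℕ./ 2                 ∎
  where open ≡-Reasoning

lemma2p2 : (D : ℕ) → 2 ℕ.≤ D → SquareFree D →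
           (t : OK) → IsUnit D t →
           (p : ℕ) → Prime p → p ℕ.% 2 ≡ 1 →
           (𝔭 : Ideal D) → SplitsAs D p 𝔭 →
           (CongModSq D (mem 𝔭) (powO D t (p ℕ.∸ 1)) (oneO D)
             ⇔ CongModSq D (ConjMem D 𝔭) (powO D t (p ℕ.∸ 1)) (oneO D))
           × (CongModSq D (ConjMem D 𝔭) (powO D t (p ℕ.∸ 1)) (oneO D)
             ⇔ PrincMem D (+ (p ℕ.* p)) (subO D (powO D t (p ℕ.∸ 1)) (oneO D)))
lemma2p2 D _ _ t t-unit p p-prime p-odd 𝔭 split =
  mk⇔ 𝔭²⇒𝔭̄² 𝔭̄²⇒𝔭² , mk⇔ (from-p*p ∘ 𝔭̄²⇒p²) (𝔭̄²⇐p² ∘ to-p*p)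
  where
  open QuadraticIntegers D
  open Splitting p-prime 𝔭 split

  x : OK
  x = t ^ (p ℕ.∸ 1)

  x⊠conj-x≡1 : x ⊠ conj x ≡ 1O
  x⊠conj-x≡1 = subst (λ n → t ^ n ⊠ conj (t ^ n) ≡ 1O) (sym (odd⇒∸1≡half+half p p-odd))
                     (unit⇒even-power-⊠-conj≡1 t-unit (p ℕ./ 2))

  𝔭²⇒𝔭̄² : CongModSq D (mem 𝔭) x 1O → CongModSq D (mem 𝔭̄) x 1O
  𝔭²⇒𝔭̄² = congModSq-conj 𝔭 𝔭̄ (λ {a} → subst (mem 𝔭) (sym (conj-involutive a))) x x⊠conj-x≡1

  𝔭̄²⇒𝔭² : CongModSq D (mem 𝔭̄) x 1O → CongModSq D (mem 𝔭) x 1O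
  𝔭̄²⇒𝔭² = congModSq-conj 𝔭̄ 𝔭 id x x⊠conj-x≡1

  𝔭̄²⇒p² : CongModSq D (mem 𝔭̄) x 1O → PrincMem D (+ p * + p) (x ⊟ 1O)
  𝔭̄²⇒p² x≡1 = comaximal⇒square∩square⊆principal² (+ p) 𝔭 𝔭̄ comaximal 𝔭𝔭̄⊆p (𝔭̄²⇒𝔭² x≡1) x≡1

  𝔭̄²⇐p² : PrincMem D (+ p * + p) (x ⊟ 1O) → CongModSq D (mem 𝔭̄) x 1O
  𝔭̄²⇐p² = principal-square⊆square (+ p) 𝔭̄ p∈𝔭̄

  from-p*p : PrincMem D (+ p * + p) (x ⊟ 1O) → PrincMem D (+ (p ℕ.* p)) (x ⊟ 1O)
  from-p*p = subst (λ n → PrincMem D n (x ⊟ 1O)) (sym (ℤ.pos-* p p))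

  to-p*p : PrincMem D (+ (p ℕ.* p)) (x ⊟ 1O) → PrincMem D (+ p * + p) (x ⊟ 1O)
  to-p*p = subst (λ n → PrincMem D n (x ⊟ 1O)) (ℤ.pos-* p p)
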